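{- Let $G$ be a finite graph with an orientation $\varepsilon$ and let $p,q$ be positive integers. The map $\mathrm{Mod}_{p,q}$, which sends an integer-valued pair $(f,g)$ to $(f\bmod p,\ g\bmod q)$, restricts to a well-defined surjective map $K_{\mathbb Z}(G,\varepsilon;p,q)\to K(G,\varepsilon;\mathbb Z_p,\mathbb Z_q)$.
   Context: $G=(V,E)$ is a finite graph, loops and multiple edges allowed, with orientation $\varepsilon$ (each edge given one of its two directions). For an abelian group $A$, $g:E\to A$ is an $A$-flow of $(G,\varepsilon)$ if at every vertex the sum of $g$ over incoming edges equals the sum over outgoing edges; $f:E\to A$ is an $A$-tension if $f(e)=h(u)-h(v)$ for every edge $e$ directed from $u$ to $v$, for some $h:V\to A$. $\ker f=\{e:f(e)=0\}$, $\operatorname{supp} g=\{e:g(e)\neq0\}$. $K(G,\varepsilon;\mathbb Z_p,\mathbb Z_q)$ is the set of pairs $(f,g)$ with $f$ a $\mathbb Z_p$-tension and $g$ a $\mathbb Z_q$-flow of $(G,\varepsilon)$ such that $\ker f=\operatorname{supp} g$. $K_{\mathbb Z}(G,\varepsilon;p,q)$ is the set of pairs $(f,g)$ with $f$ a $\mathbb Z$-tension and $g$ a $\mathbb Z$-flow of $(G,\varepsilon)$ such that for every edge $e$: $f(e)g(e)=0$, $f(e)+g(e)\neq0$, $|f(e)|<p$, $|g(e)|<q$. -}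

module Defs where

open import Data.Nat as ℕ using (ℕ; NonZero)
open import Data.Integer as ℤ using (ℤ; +_; ∣_∣)
open import Data.Integer.DivMod using (_%ℕ_; n%ℕd<d)
open import Data.Fin as Fin using (Fin; toℕ; fromℕ<; _≟_)
open import Data.Product using (Σ; _×_)
open import Relation.Binary.PropositionalEquality using (_≡_)
open import Relation.Nullary using (¬_; yes; no; Dec)

-- Loops (tail e ≡ head e) and
-- multiple edges (distinct edges with equal endpoints) are allowed.
-- The orientation ε is encoded by the choice of (tail, head).

record OGraph : Set where
  field
    nV   : ℕ
    nE   : ℕ
    tail : Fin nE → Fin nV
    head : Fin nE → Fin nV

record AbGrp : Set₁ where
  field
    Carrier : Set
    0#      : Carrier
    _+_     : Carrier → Carrier → Carrier
    -_      : Carrier → Carrier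

  _-_ : Carrier → Carrier → Carrier
  a - b = a + (- b)

  sumF : ∀ {k} → (Fin k → Carrier) → Carrier
  sumF {ℕ.zero}  x = 0#
  sumF {ℕ.suc k} x = x Fin.zero + sumF (λ i → x (Fin.suc i))

-- The integers and ℤ_p = Fin p (canonical residues 0..p-1).

ℤgrp : AbGrp
ℤgrp = record { Carrier = ℤ ; 0# = + 0 ; _+_ = ℤ._+_ ; -_ = ℤ.-_ }

modℤ : (p : ℕ) .{{_ : NonZero p}} → ℤ → Fin p
modℤ p z = fromℕ< (n%ℕd<d z p)

ℤmod : (p : ℕ) .{{_ : NonZero p}} → AbGrp
ℤmod p = record
  { Carrier = Fin p
  ; 0#      = modℤ p (+ 0)
  ; _+_     = λ a b → modℤ p (+ toℕ a ℤ.+ + toℕ b)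
  ; -_      = λ a → modℤ p (ℤ.- (+ toℕ a))
  }

module _ (G : OGraph) (A : AbGrp) where
  open OGraph G
  open AbGrp A

  ΣAt : (Fin nE → Fin nV) → Fin nV → (Fin nE → Carrier) → Carrier
  ΣAt end v x = sumF (λ e → ind (end e ≟ v) (x e))
    where
      ind : ∀ {P : Set} → Dec P → Carrier → Carrier
      ind (yes _) c = c
      ind (no _)  _ = 0#

  IsFlow : (Fin nE → Carrier) → Set
  IsFlow g = ∀ v → ΣAt head v g ≡ ΣAt tail v g

  IsTension : (Fin nE → Carrier) → Set
  IsTension f = Σ (Fin nV → Carrier) λ h → ∀ e → f e ≡ h (tail e) - h (head e)

InK : (G : OGraph) (p q : ℕ) .{{_ : NonZero p}} .{{_ : NonZero q}} →
      (Fin (OGraph.nE G) → Fin p) → (Fin (OGraph.nE G) → Fin q) → Set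
InK G p q f g =
  IsTension G (ℤmod p) f × IsFlow G (ℤmod q) g ×
  (∀ e → (f e ≡ AbGrp.0# (ℤmod p) → ¬ g e ≡ AbGrp.0# (ℤmod q)) ×
         (¬ g e ≡ AbGrp.0# (ℤmod q) → f e ≡ AbGrp.0# (ℤmod p)))
  -- i.e. ker f = supp g

InKℤ : (G : OGraph) (p q : ℕ) →
       (Fin (OGraph.nE G) → ℤ) → (Fin (OGraph.nE G) → ℤ) → Set
InKℤ G p q f g =
  IsTension G ℤgrp f × IsFlow G ℤgrp g ×
  (∀ e → (f e ℤ.* g e ≡ + 0) × ¬ (f e ℤ.+ g e ≡ + 0) ×
         (∣ f e ∣ ℕ.< p) × (∣ g e ∣ ℕ.< q))

-- Reduction modulo p and q preserves tensions and flows, and on integers of absolute value below the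
-- modulus it reflects being zero; so for pairs in K_ℤ the condition "exactly one of f e, g e vanishes"
-- is the same before and after reduction. Conversely, a ℤ_p-tension δφ′ lifts to δφ with φ the
-- representative of φ′ in [0, p). A ℤ_q-flow g′ is lifted by Tutte's argument: its representatives in
-- [0, q) lift g′ edgewise, but the excess (inflow minus outflow) at a vertex is only a multiple of q.
-- While some vertex s has positive excess, search from s along edges on which adding or subtracting q
-- keeps the lift below q in absolute value. The search reaches a vertex t of negative excess, for
-- otherwise the reached set would have positive total excess but nonpositive net inflow. Shifting q along the
-- path found moves q units of excess from s to t and decreases the total absolute excess.

module Submission where

open import Defs
open import Data.Nat using (ℕ; NonZero)
open import Data.Integer using (ℤ)
open import Data.Fin using (Fin)
open import Data.Product using (Σ; _×_)
open import Relation.Binary.PropositionalEquality using (_≡_)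

import Data.Nat as ℕ
import Data.Nat.Properties as ℕ
open import Data.Nat.DivMod using (m<n⇒m%n≡m)
open import Data.Integer
  using (+_; -[1+_]; _+_; _-_; -_; _*_; _≤_; _<_; ∣_∣; +≤+; -≤+; +<+)
import Data.Integer.Properties as ℤ
open import Data.Integer.DivMod using (_/ℕ_; a≡a%ℕn+[a/ℕn]*n)
open import Data.Integer.Tactic.RingSolver using (solve-∀)
open import Data.Fin using (zero; suc; toℕ; _≟_)
import Data.Fin.Properties as Fin
open import Data.Fin.Subset as Subset using (Subset; _∈_; _∉_; ⁅_⁆; _∪_)
import Data.Fin.Subset.Properties as Subsetₚ
open import Data.Bool using (Bool; true; false; if_then_else_)
open import Data.Product using (_,_; proj₁; proj₂; ∃)
open import Data.Sum using (inj₁; inj₂; [_,_])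
open import Data.Empty using (⊥; ⊥-elim)
open import Function using (_⇔_; mk⇔; Equivalence)
open import Function.Construct.Symmetry using (⇔-sym)
open import Function.Construct.Composition using (_⇔-∘_)
open import Relation.Nullary using (¬_; Dec; yes; no; does; ¬?; _×-dec_; _⊎-dec_)
open import Relation.Binary.PropositionalEquality
  using (_≢_; refl; sym; trans; cong; cong₂; subst; subst₂; module ≡-Reasoning)

-- Finite sums

module _ (A : AbGrp) where
  open AbGrp A using (Carrier; 0#; sumF) renaming (_+_ to _+ᴬ_)

  sumF-cong : ∀ {k} {x y : Fin k → Carrier} → (∀ i → x i ≡ y i) → sumF x ≡ sumF y
  sumF-cong {ℕ.zero}  x≗y = refl
  sumF-cong {ℕ.suc k} x≗y = cong₂ _+ᴬ_ (x≗y zero) (sumF-cong (λ i → x≗y (suc i)))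

  ΣAt-if : (G : OGraph) (end : Fin (OGraph.nE G) → Fin (OGraph.nV G)) (v : Fin (OGraph.nV G))
           (x : Fin (OGraph.nE G) → Carrier) →
           ΣAt G A end v x ≡ sumF (λ e → if does (end e ≟ v) then x e else 0#)
  ΣAt-if G = go (OGraph.nE G)
    where
      -- ΣAt only depends on the number of edges of G, so we may recurse over it.
      go : ∀ k (end : Fin k → Fin (OGraph.nV G)) v x →
           ΣAt (record { nV = OGraph.nV G ; nE = k ; tail = end ; head = end }) A end v x
             ≡ sumF (λ e → if does (end e ≟ v) then x e else 0#)
      go ℕ.zero    end v x = refl
      go (ℕ.suc k) end v x with end zero ≟ v
      ... | yes _ = cong (x zero +ᴬ_) (go k (λ i → end (suc i)) v (λ i → x (suc i)))
      ... | no _  = cong (0# +ᴬ_)     (go k (λ i → end (suc i)) v (λ i → x (suc i)))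

  ΣAt-cong : ∀ G end v {x y : Fin (OGraph.nE G) → Carrier} → (∀ e → x e ≡ y e) →
             ΣAt G A end v x ≡ ΣAt G A end v y
  ΣAt-cong G end v {x} {y} x≗y =
    trans (ΣAt-if G end v x)
          (trans (sumF-cong (λ e → cong (λ c → if does (end e ≟ v) then c else 0#) (x≗y e)))
                 (sym (ΣAt-if G end v y)))

sumℤ : ∀ {k} → (Fin k → ℤ) → ℤ
sumℤ = AbGrp.sumF ℤgrp

single : ∀ {k} → Fin k → ℤ → Fin k → ℤ
single a c i = if does (a ≟ i) then c else + 0

sumℤ-cong : ∀ {k} {x y : Fin k → ℤ} → (∀ i → x i ≡ y i) → sumℤ x ≡ sumℤ y
sumℤ-cong = sumF-cong ℤgrp

sumℤ-zero : ∀ k → sumℤ {k} (λ _ → + 0) ≡ + 0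
sumℤ-zero ℕ.zero    = refl
sumℤ-zero (ℕ.suc k) = trans (ℤ.+-identityˡ _) (sumℤ-zero k)

sumℤ-+ : ∀ {k} (x y : Fin k → ℤ) → sumℤ (λ i → x i + y i) ≡ sumℤ x + sumℤ y
sumℤ-+ {ℕ.zero}  x y = refl
sumℤ-+ {ℕ.suc k} x y =
  trans (cong (_+_ (x zero + y zero)) (sumℤ-+ (λ i → x (suc i)) (λ i → y (suc i))))
        (interchange (x zero) (y zero) _ _)
  where
    interchange : ∀ a b c d → (a + b) + (c + d) ≡ (a + c) + (b + d)
    interchange = solve-∀

sumℤ-neg : ∀ {k} (x : Fin k → ℤ) → sumℤ (λ i → - x i) ≡ - sumℤ x
sumℤ-neg {ℕ.zero}  x = refl
sumℤ-neg {ℕ.suc k} x =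
  trans (cong (_+_ (- x zero)) (sumℤ-neg (λ i → x (suc i)))) (sym (ℤ.neg-distrib-+ (x zero) _))

sumℤ-- : ∀ {k} (x y : Fin k → ℤ) → sumℤ (λ i → x i - y i) ≡ sumℤ x - sumℤ y
sumℤ-- x y = trans (sumℤ-+ x (λ i → - y i)) (cong (_+_ (sumℤ x)) (sumℤ-neg y))

sumℤ-*ˡ : ∀ {k} c (x : Fin k → ℤ) → sumℤ (λ i → c * x i) ≡ c * sumℤ x
sumℤ-*ˡ {ℕ.zero}  c x = sym (ℤ.*-zeroʳ c)
sumℤ-*ˡ {ℕ.suc k} c x =
  trans (cong (_+_ (c * x zero)) (sumℤ-*ˡ c (λ i → x (suc i)))) (sym (ℤ.*-distribˡ-+ c (x zero) _))

sumℤ-swap : ∀ {k l} (a : Fin k → Fin l → ℤ) →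
            sumℤ (λ i → sumℤ (λ j → a i j)) ≡ sumℤ (λ j → sumℤ (λ i → a i j))
sumℤ-swap {ℕ.zero}  {l} a = sym (sumℤ-zero l)
sumℤ-swap {ℕ.suc k}     a =
  trans (cong (_+_ (sumℤ (a zero))) (sumℤ-swap (λ i → a (suc i))))
        (sym (sumℤ-+ (a zero) (λ j → sumℤ (λ i → a (suc i) j))))

sumℤ-single : ∀ {k} (a : Fin k) (x : Fin k → ℤ) → sumℤ (λ i → single a (x i) i) ≡ x a
sumℤ-single {ℕ.suc k} zero    x = trans (cong (_+_ (x zero)) (sumℤ-zero k)) (ℤ.+-identityʳ (x zero))
sumℤ-single {ℕ.suc k} (suc a) x = trans (ℤ.+-identityˡ _) (sumℤ-single a (λ i → x (suc i)))

sumℤ-mono-≤ : ∀ {k} {x y : Fin k → ℤ} → (∀ i → x i ≤ y i) → sumℤ x ≤ sumℤ y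
sumℤ-mono-≤ {ℕ.zero}  x≤y = ℤ.≤-refl
sumℤ-mono-≤ {ℕ.suc k} x≤y = ℤ.+-mono-≤ (x≤y zero) (sumℤ-mono-≤ (λ i → x≤y (suc i)))

sumℤ-mono-< : ∀ {k} {x y : Fin k → ℤ} → (∀ i → x i ≤ y i) → ∀ j → x j < y j → sumℤ x < sumℤ y
sumℤ-mono-< {ℕ.suc k} x≤y zero    xj<yj = ℤ.+-mono-<-≤ xj<yj (sumℤ-mono-≤ (λ i → x≤y (suc i)))
sumℤ-mono-< {ℕ.suc k} x≤y (suc j) xj<yj = ℤ.+-mono-≤-< (x≤y zero) (sumℤ-mono-< (λ i → x≤y (suc i)) j xj<yj)

nonpos-sumℤ≡0⇒≡0 : ∀ {k} {x : Fin k → ℤ} → (∀ i → x i ≤ + 0) → sumℤ x ≡ + 0 → ∀ i → x i ≡ + 0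
nonpos-sumℤ≡0⇒≡0 {k} x≤0 Σx≡0 i = ℤ.≤-antisym (x≤0 i) (ℤ.≮⇒≥ λ xi<0 →
  ℤ.<-irrefl (trans Σx≡0 (sym (sumℤ-zero k))) (sumℤ-mono-< x≤0 i xi<0))

single-neg : ∀ {k} (a : Fin k) c i → single a (- c) i ≡ - single a c i
single-neg a c i with a ≟ i
... | yes _ = refl
... | no _  = refl

-- Integer arithmetic

*-distribˡ-- : ∀ a b c → a * (b - c) ≡ a * b - a * c
*-distribˡ-- = solve-∀

∣[+m]-[+n]∣< : ∀ {m n c} → m ℕ.< c → n ℕ.< c → ∣ + m - + n ∣ ℕ.< c
∣[+m]-[+n]∣< {m} {n} m<c n<c =
  subst (ℕ._< _) (cong ∣_∣ (sym (ℤ.[+m]-[+n]≡m⊖n m n)))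
        (ℕ.≤-<-trans (ℤ.∣m⊝n∣≤m⊔n m n) (ℕ.⊔-lub m<c n<c))

0≤i<j⇒∣i∣<∣j∣ : ∀ {i j} → + 0 ≤ i → i < j → ∣ i ∣ ℕ.< ∣ j ∣
0≤i<j⇒∣i∣<∣j∣ (+≤+ _) (+<+ m<n) = m<n

∣i-c∣<c : ∀ {i c} → + 0 < i → ∣ i ∣ ℕ.< c → ∣ i - + c ∣ ℕ.< c
∣i-c∣<c {+ n} {c} (+<+ 0<n) n<c =
  subst (ℕ._< c) (sym (trans (cong ∣_∣ (ℤ.[+m]-[+n]≡m⊖n n c)) (ℤ.∣⊖∣-< n<c)))
        (ℕ.∸-monoʳ-< 0<n (ℕ.<⇒≤ n<c))

∣i+c∣<c : ∀ {i c} → i < + 0 → ∣ i ∣ ℕ.< c → ∣ i + + c ∣ ℕ.< c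
∣i+c∣<c { -[1+ n ]} {c} _ n<c =
  subst (ℕ._< c) (sym (cong ∣_∣ (ℤ.⊖-≥ (ℕ.<⇒≤ n<c)))) (ℕ.∸-monoʳ-< ℕ.z<s (ℕ.<⇒≤ n<c))
∣i+c∣<c {+ n} (+<+ ()) _

∣kc-c∣<∣kc∣ : ∀ k c → + 0 < k * + c → ∣ k * + c - + c ∣ ℕ.< ∣ k * + c ∣
∣kc-c∣<∣kc∣ (+ ℕ.zero)  c (+<+ ())
∣kc-c∣<∣kc∣ -[1+ m ]    c 0<kc =
  ⊥-elim (ℤ.<-irrefl refl (ℤ.<-≤-trans 0<kc (ℤ.*-monoʳ-≤-nonNeg (+ c) (-≤+ {m} {0}))))
∣kc-c∣<∣kc∣ (+ ℕ.suc m) c 0<kc =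
  subst₂ ℕ._<_ (sym ∣mc∣) (sym (ℤ.abs-* (+ ℕ.suc m) (+ c))) (ℕ.m<n+m (m ℕ.* c) 0<c)
  where
    0<c : 0 ℕ.< c
    0<c = ℕ.n≢0⇒n>0 (λ { refl → ℤ.<-irrefl refl (subst (+ 0 <_) (ℤ.*-zeroʳ (+ ℕ.suc m)) 0<kc) })
    peel : ∀ m c → (+ 1 + m) * c - c ≡ m * c
    peel = solve-∀
    ∣mc∣ : ∣ + ℕ.suc m * + c - + c ∣ ≡ m ℕ.* c
    ∣mc∣ = trans (cong ∣_∣ (peel (+ m) (+ c))) (ℤ.abs-* (+ m) (+ c))

∣kc+c∣<∣kc∣ : ∀ k c → k * + c < + 0 → ∣ k * + c + + c ∣ ℕ.< ∣ k * + c ∣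
∣kc+c∣<∣kc∣ k c kc<0 = begin-strict
  ∣ k * + c + + c ∣      ≡⟨ sym (ℤ.∣-i∣≡∣i∣ (k * + c + + c)) ⟩
  ∣ - (k * + c + + c) ∣  ≡⟨ cong ∣_∣ (flip k (+ c)) ⟩
  ∣ - k * + c - + c ∣    <⟨ ∣kc-c∣<∣kc∣ (- k) c (subst (+ 0 <_) (ℤ.neg-distribˡ-* k (+ c)) (ℤ.neg-mono-< kc<0)) ⟩
  ∣ - k * + c ∣          ≡⟨ cong ∣_∣ (sym (ℤ.neg-distribˡ-* k (+ c))) ⟩
  ∣ - (k * + c) ∣        ≡⟨ ℤ.∣-i∣≡∣i∣ (k * + c) ⟩
  ∣ k * + c ∣            ∎
  where
    open ℕ.≤-Reasoning
    flip : ∀ k c → - (k * c + c) ≡ - k * c - c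
    flip = solve-∀

-- Reduction modulo q

module Reduction (q : ℕ) .{{_ : NonZero q}} where

  residue : ℤ → ℤ
  residue z = + toℕ (modℤ q z)

  residue-decomp : ∀ z → z ≡ residue z + (z /ℕ q) * + q
  residue-decomp z =
    trans (a≡a%ℕn+[a/ℕn]*n z q) (cong (λ r → + r + (z /ℕ q) * + q) (sym (Fin.toℕ-fromℕ< _)))

  small-multiple≡0 : ∀ k → ∣ k * + q ∣ ℕ.< q → k ≡ + 0
  small-multiple≡0 k ∣kq∣<q with ∣ k ∣ in ∣k∣≡ | subst (ℕ._< q) (ℤ.abs-* k (+ q)) ∣kq∣<q
  ... | ℕ.zero  | _     = ℤ.∣i∣≡0⇒i≡0 ∣k∣≡
  ... | ℕ.suc m | mq<q = ⊥-elim (ℕ.<⇒≱ mq<q (ℕ.m≤m+n q (m ℕ.* q)))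

  ≡+kq⇒modℤ≡ : ∀ x y k → x ≡ y + k * + q → modℤ q x ≡ modℤ q y
  ≡+kq⇒modℤ≡ x y k x≡y+kq = Fin.toℕ-injective (ℤ.+-injective (ℤ.i-j≡0⇒i≡j _ _ rx-ry≡0))
    where
      c : ℤ
      c = (y /ℕ q + k) - x /ℕ q
      rx-ry≡cq : residue x - residue y ≡ c * + q
      rx-ry≡cq = begin
        residue x - residue y
          ≡⟨ regroup (residue x) (residue y) (x /ℕ q) (y /ℕ q) k (+ q) ⟩
        (residue x + (x /ℕ q) * + q) - (residue y + (y /ℕ q) * + q + k * + q) + c * + q
          ≡⟨ cong₂ (λ a b → a - b + c * + q) (sym (residue-decomp x))
                   (trans (cong (_+ k * + q) (sym (residue-decomp y))) (sym x≡y+kq)) ⟩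
        x - x + c * + q
          ≡⟨ cancel x (c * + q) ⟩
        c * + q ∎
        where
          open ≡-Reasoning
          regroup : ∀ r s a b k q → r - s ≡ (r + a * q) - (s + b * q + k * q) + ((b + k) - a) * q
          regroup = solve-∀
          cancel : ∀ x y → x - x + y ≡ y
          cancel = solve-∀
      rx-ry≡0 : residue x - residue y ≡ + 0
      rx-ry≡0 = trans rx-ry≡cq (cong (_* + q) (small-multiple≡0 c
        (subst (λ t → ∣ t ∣ ℕ.< q) rx-ry≡cq
               (∣[+m]-[+n]∣< (Fin.toℕ<n (modℤ q x)) (Fin.toℕ<n (modℤ q y))))))

  modℤ≡⇒≡+kq : ∀ x y → modℤ q x ≡ modℤ q y → x ≡ y + (x /ℕ q - y /ℕ q) * + q
  modℤ≡⇒≡+kq x y x≡y = begin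
    x                                                     ≡⟨ residue-decomp x ⟩
    residue x + (x /ℕ q) * + q                            ≡⟨ cong (λ a → + toℕ a + (x /ℕ q) * + q) x≡y ⟩
    residue y + (x /ℕ q) * + q                            ≡⟨ regroup (residue y) (x /ℕ q) (y /ℕ q) (+ q) ⟩
    residue y + (y /ℕ q) * + q + (x /ℕ q - y /ℕ q) * + q  ≡⟨ cong (_+ (x /ℕ q - y /ℕ q) * + q) (sym (residue-decomp y)) ⟩
    y + (x /ℕ q - y /ℕ q) * + q                           ∎
    where
      open ≡-Reasoning
      regroup : ∀ r a b q → r + a * q ≡ r + b * q + (a - b) * q
      regroup = solve-∀

  modℤ-toℕ : ∀ (a : Fin q) → modℤ q (+ toℕ a) ≡ a
  modℤ-toℕ a = Fin.toℕ-injective (trans (Fin.toℕ-fromℕ< _) (m<n⇒m%n≡m (Fin.toℕ<n a)))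

  modℤ≡0⇒≡0 : ∀ z → ∣ z ∣ ℕ.< q → modℤ q z ≡ modℤ q (+ 0) → z ≡ + 0
  modℤ≡0⇒≡0 z ∣z∣<q z≡0 = trans z≡kq (cong (_* + q) (small-multiple≡0 k (subst (λ t → ∣ t ∣ ℕ.< q) z≡kq ∣z∣<q)))
    where
      k : ℤ
      k = z /ℕ q - + 0 /ℕ q
      z≡kq : z ≡ k * + q
      z≡kq = trans (modℤ≡⇒≡+kq z (+ 0) z≡0) (ℤ.+-identityˡ _)

  ≡0⇔modℤ≡0 : ∀ {z} → ∣ z ∣ ℕ.< q → (z ≡ + 0) ⇔ (modℤ q z ≡ modℤ q (+ 0))
  ≡0⇔modℤ≡0 {z} ∣z∣<q = mk⇔ (cong (modℤ q)) (modℤ≡0⇒≡0 z ∣z∣<q)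

  modℤ-+ : ∀ x y → modℤ q (x + y) ≡ AbGrp._+_ (ℤmod q) (modℤ q x) (modℤ q y)
  modℤ-+ x y = ≡+kq⇒modℤ≡ (x + y) (residue x + residue y) (x /ℕ q + y /ℕ q)
    (trans (cong₂ _+_ (residue-decomp x) (residue-decomp y)) (regroup (residue x) (x /ℕ q) (residue y) (y /ℕ q) (+ q)))
    where
      regroup : ∀ r a s b q → (r + a * q) + (s + b * q) ≡ (r + s) + (a + b) * q
      regroup = solve-∀

  modℤ-neg : ∀ x → modℤ q (- x) ≡ AbGrp.-_ (ℤmod q) (modℤ q x)
  modℤ-neg x = ≡+kq⇒modℤ≡ (- x) (- residue x) (- (x /ℕ q))
    (trans (cong -_ (residue-decomp x)) (regroup (residue x) (x /ℕ q) (+ q)))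
    where
      regroup : ∀ r a q → - (r + a * q) ≡ - r + (- a) * q
      regroup = solve-∀

  modℤ-- : ∀ x y → modℤ q (x - y) ≡ AbGrp._-_ (ℤmod q) (modℤ q x) (modℤ q y)
  modℤ-- x y = trans (modℤ-+ x (- y)) (cong (λ a → modℤ q (residue x + + toℕ a)) (modℤ-neg y))

  modℤ-sumℤ : ∀ {k} (x : Fin k → ℤ) → modℤ q (sumℤ x) ≡ AbGrp.sumF (ℤmod q) (λ i → modℤ q (x i))
  modℤ-sumℤ {ℕ.zero}  x = refl
  modℤ-sumℤ {ℕ.suc k} x = trans (modℤ-+ (x zero) (sumℤ (λ i → x (suc i))))
    (cong (λ a → modℤ q (residue (x zero) + + toℕ a)) (modℤ-sumℤ (λ i → x (suc i))))

  modℤ-ΣAt : ∀ G end v (h : Fin (OGraph.nE G) → ℤ) →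
             modℤ q (ΣAt G ℤgrp end v h) ≡ ΣAt G (ℤmod q) end v (λ e → modℤ q (h e))
  modℤ-ΣAt G end v h = begin
    modℤ q (ΣAt G ℤgrp end v h)
      ≡⟨ cong (modℤ q) (ΣAt-if ℤgrp G end v h) ⟩
    modℤ q (sumℤ (λ e → if does (end e ≟ v) then h e else + 0))
      ≡⟨ modℤ-sumℤ (λ e → if does (end e ≟ v) then h e else + 0) ⟩
    AbGrp.sumF (ℤmod q) (λ e → modℤ q (if does (end e ≟ v) then h e else + 0))
      ≡⟨ sumF-cong (ℤmod q) (λ e → modℤ-if (does (end e ≟ v)) (h e)) ⟩
    AbGrp.sumF (ℤmod q) (λ e → if does (end e ≟ v) then modℤ q (h e) else modℤ q (+ 0))
      ≡⟨ sym (ΣAt-if (ℤmod q) G end v (λ e → modℤ q (h e))) ⟩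
    ΣAt G (ℤmod q) end v (λ e → modℤ q (h e)) ∎
    where
      open ≡-Reasoning
      modℤ-if : ∀ b c → modℤ q (if b then c else + 0) ≡ (if b then modℤ q c else modℤ q (+ 0))
      modℤ-if true  c = refl
      modℤ-if false c = refl

  module _ (G : OGraph) where
    open OGraph G

    reduce-flow : ∀ g → IsFlow G ℤgrp g → IsFlow G (ℤmod q) (λ e → modℤ q (g e))
    reduce-flow g in≡out v =
      trans (sym (modℤ-ΣAt G head v g)) (trans (cong (modℤ q) (in≡out v)) (modℤ-ΣAt G tail v g))

    reduce-tension : ∀ f → IsTension G ℤgrp f → IsTension G (ℤmod q) (λ e → modℤ q (f e))
    reduce-tension f (h , f≡δh) =
      (λ v → modℤ q (h v)) , λ e → trans (cong (modℤ q) (f≡δh e)) (modℤ-- (h (tail e)) (h (head e)))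

    lift-tension : ∀ f′ → IsTension G (ℤmod q) f′ →
                   Σ (Fin nE → ℤ) λ f → IsTension G ℤgrp f × (∀ e → modℤ q (f e) ≡ f′ e × ∣ f e ∣ ℕ.< q)
    lift-tension f′ (φ′ , f′≡δφ′) =
      f , (φ , λ _ → refl) , λ e → reduces e , ∣[+m]-[+n]∣< (Fin.toℕ<n (φ′ (tail e))) (Fin.toℕ<n (φ′ (head e)))
      where
        φ : Fin nV → ℤ
        φ v = + toℕ (φ′ v)
        f : Fin nE → ℤ
        f e = φ (tail e) - φ (head e)
        reduces : ∀ e → modℤ q (f e) ≡ f′ e
        reduces e = trans (modℤ-- (φ (tail e)) (φ (head e)))
                          (trans (cong₂ (AbGrp._-_ (ℤmod q)) (modℤ-toℕ (φ′ (tail e))) (modℤ-toℕ (φ′ (head e))))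
                                 (sym (f′≡δφ′ e)))

-- The edge condition

Complementary : Set → Set → Set
Complementary A B = (A → ¬ B) × (¬ B → A)

Complementary-cong : ∀ {A A′ B B′} → A ⇔ A′ → B ⇔ B′ → Complementary A B ⇔ Complementary A′ B′
Complementary-cong A⇔A′ B⇔B′ = mk⇔ (transport A⇔A′ B⇔B′) (transport (⇔-sym A⇔A′) (⇔-sym B⇔B′))
  where
    open Equivalence
    transport : ∀ {A A′ B B′} → A ⇔ A′ → B ⇔ B′ → Complementary A B → Complementary A′ B′
    transport A⇔A′ B⇔B′ (A→¬B , ¬B→A) =
      (λ a′ b′ → A→¬B (from A⇔A′ a′) (from B⇔B′ b′)) , (λ ¬b′ → to A⇔A′ (¬B→A (λ b → ¬b′ (to B⇔B′ b))))

*≡0×+≢0⇔Complementary : ∀ f g → (f * g ≡ + 0 × ¬ f + g ≡ + 0) ⇔ Complementary (f ≡ + 0) (g ≡ + 0)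
*≡0×+≢0⇔Complementary f g = mk⇔ to from
  where
    to : f * g ≡ + 0 × ¬ f + g ≡ + 0 → Complementary (f ≡ + 0) (g ≡ + 0)
    to (fg≡0 , f+g≢0) =
      (λ f≡0 g≡0 → f+g≢0 (cong₂ _+_ f≡0 g≡0)) ,
      (λ g≢0 → [ (λ f≡0 → f≡0) , (λ g≡0 → ⊥-elim (g≢0 g≡0)) ] (ℤ.i*j≡0⇒i≡0∨j≡0 f fg≡0))
    from : Complementary (f ≡ + 0) (g ≡ + 0) → f * g ≡ + 0 × ¬ f + g ≡ + 0
    from (f≡0→g≢0 , g≢0→f≡0) with g ℤ.≟ + 0
    ... | yes g≡0 = trans (cong (f *_) g≡0) (ℤ.*-zeroʳ f) ,
                    λ f+g≡0 → f≡0→g≢0 (trans (sym (ℤ.+-identityʳ f)) (trans (cong (_+_ f) (sym g≡0)) f+g≡0)) g≡0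
    ... | no g≢0  = let f≡0 = g≢0→f≡0 g≢0 in
                    trans (cong (_* g) f≡0) (ℤ.*-zeroˡ g) ,
                    λ f+g≡0 → g≢0 (trans (sym (ℤ.+-identityˡ g)) (trans (cong (_+ g) (sym f≡0)) f+g≡0))

edge-condition⇔ : ∀ (p q : ℕ) .{{_ : NonZero p}} .{{_ : NonZero q}} (f g : ℤ) → ∣ f ∣ ℕ.< p → ∣ g ∣ ℕ.< q →
                  (f * g ≡ + 0 × ¬ f + g ≡ + 0) ⇔ Complementary (modℤ p f ≡ modℤ p (+ 0)) (modℤ q g ≡ modℤ q (+ 0))
edge-condition⇔ p q f g ∣f∣<p ∣g∣<q =
  Complementary-cong (Reduction.≡0⇔modℤ≡0 p ∣f∣<p) (Reduction.≡0⇔modℤ≡0 q ∣g∣<q) ⇔-∘ *≡0×+≢0⇔Complementary f g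

reduce-edge : ∀ (p q : ℕ) .{{_ : NonZero p}} .{{_ : NonZero q}} f g →
              (f * g ≡ + 0) × ¬ (f + g ≡ + 0) × (∣ f ∣ ℕ.< p) × (∣ g ∣ ℕ.< q) →
              Complementary (modℤ p f ≡ modℤ p (+ 0)) (modℤ q g ≡ modℤ q (+ 0))
reduce-edge p q f g (fg≡0 , f+g≢0 , ∣f∣<p , ∣g∣<q) =
  Equivalence.to (edge-condition⇔ p q f g ∣f∣<p ∣g∣<q) (fg≡0 , f+g≢0)

lift-edge : ∀ (p q : ℕ) .{{_ : NonZero p}} .{{_ : NonZero q}} f g {f′ g′} →
            modℤ p f ≡ f′ × ∣ f ∣ ℕ.< p → modℤ q g ≡ g′ × ∣ g ∣ ℕ.< q →
            Complementary (f′ ≡ modℤ p (+ 0)) (g′ ≡ modℤ q (+ 0)) →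
            (f * g ≡ + 0) × ¬ (f + g ≡ + 0) × (∣ f ∣ ℕ.< p) × (∣ g ∣ ℕ.< q)
lift-edge p q f g (refl , ∣f∣<p) (refl , ∣g∣<q) complementary =
  let (fg≡0 , f+g≢0) = Equivalence.from (edge-condition⇔ p q f g ∣f∣<p ∣g∣<q) complementary
  in fg≡0 , f+g≢0 , ∣f∣<p , ∣g∣<q

-- Lifting flows

x∈p∪⁅x⁆ : ∀ {n} {p : Subset n} x → x ∈ p ∪ ⁅ x ⁆
x∈p∪⁅x⁆ x = Subsetₚ.x∈p∪q⁺ (inj₂ (Subsetₚ.x∈⁅x⁆ x))

n∸∣p∪⁅x⁆∣<n∸∣p∣ : ∀ {n} {p : Subset n} {x} → x ∉ p → n ℕ.∸ Subset.∣ p ∪ ⁅ x ⁆ ∣ ℕ.< n ℕ.∸ Subset.∣ p ∣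
n∸∣p∪⁅x⁆∣<n∸∣p∣ {p = p} {x} x∉p = ℕ.∸-monoʳ-<
  (Subsetₚ.p⊂q⇒∣p∣<∣q∣ (Subsetₚ.p⊆p∪q ⁅ x ⁆ , x , x∈p∪⁅x⁆ x , x∉p)) (Subsetₚ.∣p∣≤n (p ∪ ⁅ x ⁆))

module Excess (G : OGraph) where
  open OGraph G

  excess : (Fin nE → ℤ) → Fin nV → ℤ
  excess h v = ΣAt G ℤgrp head v h - ΣAt G ℤgrp tail v h

  excess≡0⇒IsFlow : ∀ h → (∀ v → excess h v ≡ + 0) → IsFlow G ℤgrp h
  excess≡0⇒IsFlow h excess≡0 v = ℤ.i-j≡0⇒i≡j _ _ (excess≡0 v)

  ΣAt-weighted : ∀ end (b : Fin nV → ℤ) h →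
                 sumℤ (λ v → b v * ΣAt G ℤgrp end v h) ≡ sumℤ (λ e → h e * b (end e))
  ΣAt-weighted end b h = begin
    sumℤ (λ v → b v * ΣAt G ℤgrp end v h)
      ≡⟨ sumℤ-cong (λ v → trans (cong (b v *_) (ΣAt-if ℤgrp G end v h)) (sym (sumℤ-*ˡ (b v) (term v)))) ⟩
    sumℤ (λ v → sumℤ (λ e → b v * term v e))
      ≡⟨ sumℤ-swap (λ v e → b v * term v e) ⟩
    sumℤ (λ e → sumℤ (λ v → b v * term v e))
      ≡⟨ sumℤ-cong (λ e → trans (sumℤ-cong (λ v → pick (does (end e ≟ v)) (b v) (h e)))
                                (sumℤ-single (end e) (λ v → h e * b v))) ⟩
    sumℤ (λ e → h e * b (end e)) ∎
    where
      open ≡-Reasoning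
      term : Fin nV → Fin nE → ℤ
      term v e = if does (end e ≟ v) then h e else + 0
      pick : ∀ β c x → c * (if β then x else + 0) ≡ (if β then x * c else + 0)
      pick true  c x = ℤ.*-comm c x
      pick false c x = ℤ.*-zeroʳ c

  excess-weighted : ∀ (b : Fin nV → ℤ) h →
                    sumℤ (λ v → b v * excess h v) ≡ sumℤ (λ e → h e * (b (head e) - b (tail e)))
  excess-weighted b h = begin
    sumℤ (λ v → b v * excess h v)
      ≡⟨ sumℤ-cong (λ v → *-distribˡ-- (b v) _ _) ⟩
    sumℤ (λ v → b v * ΣAt G ℤgrp head v h - b v * ΣAt G ℤgrp tail v h)
      ≡⟨ sumℤ-- (λ v → b v * ΣAt G ℤgrp head v h) (λ v → b v * ΣAt G ℤgrp tail v h) ⟩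
    sumℤ (λ v → b v * ΣAt G ℤgrp head v h) - sumℤ (λ v → b v * ΣAt G ℤgrp tail v h)
      ≡⟨ cong₂ _-_ (ΣAt-weighted head b h) (ΣAt-weighted tail b h) ⟩
    sumℤ (λ e → h e * b (head e)) - sumℤ (λ e → h e * b (tail e))
      ≡⟨ sym (sumℤ-- (λ e → h e * b (head e)) (λ e → h e * b (tail e))) ⟩
    sumℤ (λ e → h e * b (head e) - h e * b (tail e))
      ≡⟨ sumℤ-cong (λ e → sym (*-distribˡ-- (h e) _ _)) ⟩
    sumℤ (λ e → h e * (b (head e) - b (tail e))) ∎
    where open ≡-Reasoning

  sumℤ-excess : ∀ h → sumℤ (excess h) ≡ + 0
  sumℤ-excess h = begin
    sumℤ (excess h)                                   ≡⟨ sumℤ-cong (λ v → sym (ℤ.*-identityˡ (excess h v))) ⟩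
    sumℤ (λ v → + 1 * excess h v)                     ≡⟨ excess-weighted (λ _ → + 1) h ⟩
    sumℤ (λ e → h e * (+ 1 - + 1))                    ≡⟨ sumℤ-cong (λ e → ℤ.*-zeroʳ (h e)) ⟩
    sumℤ {nE} (λ _ → + 0)                             ≡⟨ sumℤ-zero nE ⟩
    + 0                                               ∎
    where open ≡-Reasoning

  bump : (Fin nE → ℤ) → Fin nE → ℤ → Fin nE → ℤ
  bump h e c e′ = h e′ + single e c e′

  ΣAt-bump : ∀ end v h e c → ΣAt G ℤgrp end v (bump h e c) ≡ ΣAt G ℤgrp end v h + single (end e) c v
  ΣAt-bump end v h e c = begin
    ΣAt G ℤgrp end v (bump h e c)
      ≡⟨ ΣAt-if ℤgrp G end v (bump h e c) ⟩
    sumℤ (λ e′ → if at e′ then h e′ + single e c e′ else + 0)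
      ≡⟨ sumℤ-cong (λ e′ → split (at e′) (does (e ≟ e′)) (h e′) c) ⟩
    sumℤ (λ e′ → (if at e′ then h e′ else + 0) + single e (if at e′ then c else + 0) e′)
      ≡⟨ sumℤ-+ (λ e′ → if at e′ then h e′ else + 0) (λ e′ → single e (if at e′ then c else + 0) e′) ⟩
    sumℤ (λ e′ → if at e′ then h e′ else + 0) + sumℤ (λ e′ → single e (if at e′ then c else + 0) e′)
      ≡⟨ cong₂ _+_ (sym (ΣAt-if ℤgrp G end v h)) (sumℤ-single e (λ e′ → if at e′ then c else + 0)) ⟩
    ΣAt G ℤgrp end v h + single (end e) c v ∎
    where
      open ≡-Reasoning
      at : Fin nE → Bool
      at e′ = does (end e′ ≟ v)
      split : ∀ β γ x c → (if β then x + (if γ then c else + 0) else + 0)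
                          ≡ (if β then x else + 0) + (if γ then (if β then c else + 0) else + 0)
      split true  γ     x c = refl
      split false true  x c = refl
      split false false x c = refl

  bump-≢ : ∀ h {e e′} c → e ≢ e′ → bump h e c e′ ≡ h e′
  bump-≢ h {e} {e′} c e≢e′ with e ≟ e′
  ... | yes e≡e′ = ⊥-elim (e≢e′ e≡e′)
  ... | no _     = ℤ.+-identityʳ (h e′)

  excess-bump : ∀ h e c v → excess (bump h e c) v ≡ excess h v + single (head e) c v - single (tail e) c v
  excess-bump h e c v =
    trans (cong₂ _-_ (ΣAt-bump head v h e c) (ΣAt-bump tail v h e c))
          (regroup (ΣAt G ℤgrp head v h) (ΣAt G ℤgrp tail v h) (single (head e) c v) (single (tail e) c v))
    where
      regroup : ∀ a b x y → (a + x) - (b + y) ≡ (a - b) + x - y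
      regroup = solve-∀

module FlowLifting (G : OGraph) (q : ℕ) .{{_ : NonZero q}}
                   (g′ : Fin (OGraph.nE G) → Fin q) (g′-flow : IsFlow G (ℤmod q) g′) where
  open OGraph G
  open Excess G
  open Reduction q

  Lifts : (Fin nE → ℤ) → Set
  Lifts h = ∀ e → modℤ q (h e) ≡ g′ e × ∣ h e ∣ ℕ.< q

  excess-multiple : ∀ {h} → Lifts h → ∀ v → ∃ λ k → excess h v ≡ k * + q
  excess-multiple {h} h-lifts v =
    k , trans (cong (_- out) (modℤ≡⇒≡+kq in′ out in≡out)) (cancel out (k * + q))
    where
      in′ out : ℤ
      in′ = ΣAt G ℤgrp head v h
      out = ΣAt G ℤgrp tail v h
      k : ℤ
      k = in′ /ℕ q - out /ℕ q
      reduce : ∀ end → modℤ q (ΣAt G ℤgrp end v h) ≡ ΣAt G (ℤmod q) end v g′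
      reduce end = trans (modℤ-ΣAt G end v h) (ΣAt-cong (ℤmod q) G end v (λ e → proj₁ (h-lifts e)))
      in≡out : modℤ q in′ ≡ modℤ q out
      in≡out = trans (reduce head) (trans (g′-flow v) (sym (reduce tail)))
      cancel : ∀ a b → a + b - a ≡ b
      cancel = solve-∀

  Lifts-bump : ∀ {h} → Lifts h → ∀ e k {c} → c ≡ k * + q → ∣ h e + c ∣ ℕ.< q → Lifts (bump h e c)
  Lifts-bump {h} h-lifts e k {c} c≡kq bound e′ with e ≟ e′
  ... | yes refl = trans (≡+kq⇒modℤ≡ (h e + c) (h e) k (cong (_+_ (h e)) c≡kq)) (proj₁ (h-lifts e)) , bound
  ... | no _     = subst (λ x → modℤ q x ≡ g′ e′ × ∣ x ∣ ℕ.< q) (sym (ℤ.+-identityʳ (h e′))) (h-lifts e′)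

  module Reroute {g} (g-lifts : Lifts g) (s : Fin nV) (0<excess[s] : + 0 < excess g s) where

    Rerouted : Fin nV → (Fin nE → ℤ) → Set
    Rerouted v h = Lifts h × (∀ w → excess h w ≡ excess g w - single s (+ q) w + single v (+ q) w)

    push-forward : ∀ {h} e → Rerouted (head e) h → + 0 < h e → Rerouted (tail e) (bump h e (- + q))
    push-forward {h} e (h-lifts , h-excess) 0<he =
      Lifts-bump {h} h-lifts e (- + 1) (sym (ℤ.-1*i≡-i (+ q))) (∣i-c∣<c 0<he (proj₂ (h-lifts e))) ,
      λ w → begin
        excess (bump h e (- + q)) w
          ≡⟨ excess-bump h e (- + q) w ⟩
        excess h w + single (head e) (- + q) w - single (tail e) (- + q) w
          ≡⟨ cong₂ (λ x y → excess h w + x - y) (single-neg (head e) (+ q) w) (single-neg (tail e) (+ q) w) ⟩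
        excess h w + - single (head e) (+ q) w - - single (tail e) (+ q) w
          ≡⟨ cong (λ x → x + - single (head e) (+ q) w - - single (tail e) (+ q) w) (h-excess w) ⟩
        excess g w - single s (+ q) w + single (head e) (+ q) w + - single (head e) (+ q) w - - single (tail e) (+ q) w
          ≡⟨ regroup (excess g w) (single s (+ q) w) (single (head e) (+ q) w) (single (tail e) (+ q) w) ⟩
        excess g w - single s (+ q) w + single (tail e) (+ q) w ∎
      where
        open ≡-Reasoning
        regroup : ∀ x σ a b → x - σ + a + - a - - b ≡ x - σ + b
        regroup = solve-∀

    push-backward : ∀ {h} e → Rerouted (tail e) h → h e < + 0 → Rerouted (head e) (bump h e (+ q))
    push-backward {h} e (h-lifts , h-excess) he<0 =
      Lifts-bump {h} h-lifts e (+ 1) (sym (ℤ.*-identityˡ (+ q))) (∣i+c∣<c he<0 (proj₂ (h-lifts e))) ,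
      λ w → begin
        excess (bump h e (+ q)) w
          ≡⟨ excess-bump h e (+ q) w ⟩
        excess h w + single (head e) (+ q) w - single (tail e) (+ q) w
          ≡⟨ cong (λ x → x + single (head e) (+ q) w - single (tail e) (+ q) w) (h-excess w) ⟩
        excess g w - single s (+ q) w + single (tail e) (+ q) w + single (head e) (+ q) w - single (tail e) (+ q) w
          ≡⟨ regroup (excess g w) (single s (+ q) w) (single (tail e) (+ q) w) (single (head e) (+ q) w) ⟩
        excess g w - single s (+ q) w + single (head e) (+ q) w ∎
      where
        open ≡-Reasoning
        regroup : ∀ x σ a b → x - σ + a + b - a ≡ x - σ + b
        regroup = solve-∀

    Internal : Subset nV → Fin nE → Set
    Internal S e = head e ∈ S × tail e ∈ S

    -- A lift obtained from g by moving q units of excess from s to v, changing only edges inside S.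
    Witness : Subset nV → Fin nV → Set
    Witness S v = Σ (Fin nE → ℤ) λ h → Rerouted v h × (∀ e → ¬ Internal S e → h e ≡ g e)

    Explored : Subset nV → Set
    Explored S = s ∈ S × (∀ v → v ∈ S → Witness S v)

    ForwardExit BackwardExit : Subset nV → Fin nE → Set
    ForwardExit  S e = head e ∈ S × tail e ∉ S × + 0 < g e
    BackwardExit S e = tail e ∈ S × head e ∉ S × g e < + 0

    extend : ∀ {S} → Explored S → ∀ {a b} e {c} → a ∈ S → b ∉ S → ¬ Internal S e → Internal (S ∪ ⁅ b ⁆) e →
             (∀ {h} → Rerouted a h → h e ≡ g e → Rerouted b (bump h e c)) → Explored (S ∪ ⁅ b ⁆)
    extend {S} (s∈S , witness) {a} {b} e {c} a∈S b∉S e-outside e-inside push =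
      S⊆S′ s∈S , witness′
      where
        S⊆S′ : S Subset.⊆ S ∪ ⁅ b ⁆
        S⊆S′ = Subsetₚ.p⊆p∪q ⁅ b ⁆
        outside′ : ∀ {e′} → ¬ Internal (S ∪ ⁅ b ⁆) e′ → ¬ Internal S e′
        outside′ e′-outside (h∈S , t∈S) = e′-outside (S⊆S′ h∈S , S⊆S′ t∈S)
        witness′ : ∀ v → v ∈ S ∪ ⁅ b ⁆ → Witness (S ∪ ⁅ b ⁆) v
        witness′ v v∈S′ with Subsetₚ.x∈p∪q⁻ S ⁅ b ⁆ v∈S′
        ... | inj₁ v∈S = let (h , rerouted , agrees) = witness v v∈S in
                         h , rerouted , λ e′ e′-outside → agrees e′ (outside′ e′-outside)
        ... | inj₂ v∈⁅b⁆ with Subsetₚ.x∈⁅y⁆⇒x≡y b v∈⁅b⁆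
        ...   | refl = let (h , rerouted , agrees) = witness a a∈S in
                       bump h e c , push rerouted (agrees e e-outside) ,
                       λ e′ e′-outside → trans (bump-≢ h {e} c (λ { refl → e′-outside e-inside }))
                                               (agrees e′ (outside′ e′-outside))

    -- The excess summed over S is the net flow of g into S: positive because of s, yet at most 0
    -- when no edge of g can carry excess out of S.
    closed-contradiction : ∀ S → s ∈ S → (∀ v → v ∈ S → + 0 ≤ excess g v) →
                           (∀ e → ¬ ForwardExit S e) → (∀ e → ¬ BackwardExit S e) → ⊥
    closed-contradiction S s∈S nonneg no-forward no-backward =
      ℤ.<-irrefl refl (ℤ.<-≤-trans 0<Σ (subst (_≤ + 0) (sym (excess-weighted 𝟙 g)) Σ≤0))
      where
        𝟙 : Fin nV → ℤ
        𝟙 v = if does (v Subsetₚ.∈? S) then + 1 else + 0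
        vertex-term : ∀ v → + 0 ≤ 𝟙 v * excess g v
        vertex-term v with v Subsetₚ.∈? S
        ... | yes v∈S = subst (+ 0 ≤_) (sym (ℤ.*-identityˡ (excess g v))) (nonneg v v∈S)
        ... | no _    = ℤ.≤-refl
        source-term : + 0 < 𝟙 s * excess g s
        source-term with s Subsetₚ.∈? S
        ... | yes _   = subst (+ 0 <_) (sym (ℤ.*-identityˡ (excess g s))) 0<excess[s]
        ... | no s∉S  = ⊥-elim (s∉S s∈S)
        0<Σ : + 0 < sumℤ (λ v → 𝟙 v * excess g v)
        0<Σ = subst (_< sumℤ (λ v → 𝟙 v * excess g v)) (sumℤ-zero nV) (sumℤ-mono-< vertex-term s source-term)
        edge-term : ∀ e → g e * (𝟙 (head e) - 𝟙 (tail e)) ≤ + 0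
        edge-term e with head e Subsetₚ.∈? S | tail e Subsetₚ.∈? S
        ... | yes _   | yes _   = subst (_≤ + 0) (sym (ℤ.*-zeroʳ (g e))) ℤ.≤-refl
        ... | no _    | no _    = subst (_≤ + 0) (sym (ℤ.*-zeroʳ (g e))) ℤ.≤-refl
        ... | yes h∈S | no t∉S  = subst (_≤ + 0) (sym (ℤ.*-identityʳ (g e)))
                                    (ℤ.≮⇒≥ λ 0<ge → no-forward e (h∈S , t∉S , 0<ge))
        ... | no h∉S  | yes t∈S = subst (_≤ + 0) (sym (trans (ℤ.*-comm (g e) (- + 1)) (ℤ.-1*i≡-i (g e))))
                                    (ℤ.neg-mono-≤ (ℤ.≮⇒≥ λ ge<0 → no-backward e (t∈S , h∉S , ge<0)))
        Σ≤0 : sumℤ (λ e → g e * (𝟙 (head e) - 𝟙 (tail e))) ≤ + 0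
        Σ≤0 = subst (sumℤ (λ e → g e * (𝟙 (head e) - 𝟙 (tail e))) ≤_) (sumℤ-zero nE) (sumℤ-mono-≤ edge-term)

    extend-forward : ∀ {S} → Explored S → ∀ e → ForwardExit S e → Explored (S ∪ ⁅ tail e ⁆)
    extend-forward explored e (h∈S , t∉S , 0<ge) =
      extend explored e h∈S t∉S (λ (_ , t∈S) → t∉S t∈S) (Subsetₚ.p⊆p∪q ⁅ tail e ⁆ h∈S , x∈p∪⁅x⁆ (tail e))
        (λ rerouted he≡ge → push-forward e rerouted (subst (+ 0 <_) (sym he≡ge) 0<ge))

    extend-backward : ∀ {S} → Explored S → ∀ e → BackwardExit S e → Explored (S ∪ ⁅ head e ⁆)
    extend-backward explored e (t∈S , h∉S , ge<0) =
      extend explored e t∈S h∉S (λ (h∈S , _) → h∉S h∈S) (x∈p∪⁅x⁆ (head e) , Subsetₚ.p⊆p∪q ⁅ head e ⁆ t∈S)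
        (λ rerouted he≡ge → push-backward e rerouted (subst (_< + 0) (sym he≡ge) ge<0))

    Sink : Set
    Sink = Σ (Fin nV) λ t → Σ (Fin nE → ℤ) λ h → Rerouted t h × excess g t < + 0

    explore : ∀ n S → nV ℕ.∸ Subset.∣ S ∣ ℕ.< n → Explored S → Sink
    explore (ℕ.suc n) S fuel explored@(s∈S , witness)
      with Fin.any? (λ v → v Subsetₚ.∈? S ×-dec excess g v ℤ.<? + 0)
    ... | yes (t , t∈S , excess<0) = let (h , rerouted , _) = witness t t∈S in t , h , rerouted , excess<0
    ... | no no-sink with Fin.any? (λ e → forward? e ⊎-dec backward? e)
      where
        forward? : ∀ e → Dec (ForwardExit S e)
        forward? e = head e Subsetₚ.∈? S ×-dec ¬? (tail e Subsetₚ.∈? S) ×-dec + 0 ℤ.<? g e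
        backward? : ∀ e → Dec (BackwardExit S e)
        backward? e = tail e Subsetₚ.∈? S ×-dec ¬? (head e Subsetₚ.∈? S) ×-dec g e ℤ.<? + 0
    ...   | yes (e , inj₁ exit@(_ , t∉S , _)) =
            explore n (S ∪ ⁅ tail e ⁆) (ℕ.<-≤-trans (n∸∣p∪⁅x⁆∣<n∸∣p∣ t∉S) (ℕ.s≤s⁻¹ fuel))
                    (extend-forward explored e exit)
    ...   | yes (e , inj₂ exit@(_ , h∉S , _)) =
            explore n (S ∪ ⁅ head e ⁆) (ℕ.<-≤-trans (n∸∣p∪⁅x⁆∣<n∸∣p∣ h∉S) (ℕ.s≤s⁻¹ fuel))
                    (extend-backward explored e exit)
    ...   | no no-exit = ⊥-elim (closed-contradiction S s∈S
              (λ v v∈S → ℤ.≮⇒≥ λ excess<0 → no-sink (v , v∈S , excess<0))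
              (λ e exit → no-exit (e , inj₁ exit)) (λ e exit → no-exit (e , inj₂ exit)))

    sink : Sink
    sink = explore (ℕ.suc nV) ⁅ s ⁆ (ℕ.s≤s (ℕ.m∸n≤m nV Subset.∣ ⁅ s ⁆ ∣)) (Subsetₚ.x∈⁅x⁆ s , start)
      where
        start : ∀ v → v ∈ ⁅ s ⁆ → Witness ⁅ s ⁆ v
        start v v∈⁅s⁆ with Subsetₚ.x∈⁅y⁆⇒x≡y s v∈⁅s⁆
        ... | refl = g , (g-lifts , λ w → sym (cancel (excess g w) (single s (+ q) w))) , λ _ _ → refl
          where
            cancel : ∀ x σ → x - σ + σ ≡ x
            cancel = solve-∀

  weight : (Fin nE → ℤ) → ℤ
  weight h = sumℤ (λ v → + ∣ excess h v ∣)

  0≤weight : ∀ h → + 0 ≤ weight h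
  0≤weight h = subst (_≤ weight h) (sumℤ-zero nV)
                     (sumℤ-mono-≤ {x = λ _ → + 0} {y = λ v → + ∣ excess h v ∣} (λ _ → +≤+ ℕ.z≤n))

  rerouting-decreases-weight : ∀ {g h s t} → Lifts g → + 0 < excess g s → excess g t < + 0 →
    (∀ w → excess h w ≡ excess g w - single s (+ q) w + single t (+ q) w) → weight h < weight g
  rerouting-decreases-weight {g} {h} {s} {t} g-lifts 0<excess[s] excess[t]<0 h-excess =
    sumℤ-mono-< (λ w → pointwise w (h-excess w)) s (+<+ at-s)
    where
      s≢t : s ≢ t
      s≢t refl = ℤ.<-irrefl refl (ℤ.<-trans 0<excess[s] excess[t]<0)
      shrink-s : ∣ excess g s - + q ∣ ℕ.< ∣ excess g s ∣
      shrink-s with excess-multiple g-lifts s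
      ... | k , x≡kq = subst (λ x → ∣ x - + q ∣ ℕ.< ∣ x ∣) (sym x≡kq)
                             (∣kc-c∣<∣kc∣ k q (subst (+ 0 <_) x≡kq 0<excess[s]))
      shrink-t : ∣ excess g t + + q ∣ ℕ.< ∣ excess g t ∣
      shrink-t with excess-multiple g-lifts t
      ... | k , x≡kq = subst (λ x → ∣ x + + q ∣ ℕ.< ∣ x ∣) (sym x≡kq)
                             (∣kc+c∣<∣kc∣ k q (subst (_< + 0) x≡kq excess[t]<0))
      at-s′ : excess h s ≡ excess g s - single s (+ q) s + single t (+ q) s → ∣ excess h s ∣ ℕ.< ∣ excess g s ∣
      at-s′ h-excess[s] with s ≟ s | t ≟ s
      ... | no s≢s  | _         = ⊥-elim (s≢s refl)
      ... | yes _   | yes refl  = ⊥-elim (s≢t refl)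
      ... | yes _   | no _      = subst (ℕ._< ∣ excess g s ∣)
                                    (cong ∣_∣ (sym (trans h-excess[s] (ℤ.+-identityʳ (excess g s - + q))))) shrink-s
      at-s : ∣ excess h s ∣ ℕ.< ∣ excess g s ∣
      at-s = at-s′ (h-excess s)
      pointwise : ∀ w → excess h w ≡ excess g w - single s (+ q) w + single t (+ q) w → + ∣ excess h w ∣ ≤ + ∣ excess g w ∣
      pointwise w h-excess[w] with s ≟ w | t ≟ w
      ... | yes refl | yes refl = ⊥-elim (s≢t refl)
      ... | yes refl | no _     = +≤+ (ℕ.<⇒≤ at-s)
      ... | no _     | yes refl = +≤+ (ℕ.<⇒≤ (subst (ℕ._< ∣ excess g t ∣)
                                    (cong ∣_∣ (sym (trans h-excess[w] (cong (_+ + q) (ℤ.+-identityʳ (excess g w)))))) shrink-t))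
      ... | no _     | no _     = +≤+ (ℕ.≤-reflexive (cong ∣_∣ (trans h-excess[w]
                                    (trans (ℤ.+-identityʳ (excess g w - + 0)) (ℤ.+-identityʳ (excess g w))))))

  settle : ∀ n h → Lifts h → ∣ weight h ∣ ℕ.< n → Σ (Fin nE → ℤ) λ g → IsFlow G ℤgrp g × Lifts g
  settle (ℕ.suc n) h h-lifts fuel with Fin.any? (λ v → + 0 ℤ.<? excess h v)
  ... | yes (s , 0<excess[s]) =
        let (t , h′ , (h′-lifts , h′-excess) , excess[t]<0) = Reroute.sink h-lifts s 0<excess[s]
            lighter = rerouting-decreases-weight h-lifts 0<excess[s] excess[t]<0 h′-excess
        in settle n h′ h′-lifts (ℕ.<-≤-trans (0≤i<j⇒∣i∣<∣j∣ (0≤weight h′) lighter) (ℕ.s≤s⁻¹ fuel))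
  ... | no no-source =
        h , excess≡0⇒IsFlow h (nonpos-sumℤ≡0⇒≡0 (λ v → ℤ.≮⇒≥ λ 0<excess → no-source (v , 0<excess))
                                                (sumℤ-excess h)) , h-lifts

  lift : Σ (Fin nE → ℤ) λ g → IsFlow G ℤgrp g × Lifts g
  lift = settle (ℕ.suc ∣ weight canonical ∣) canonical (λ e → modℤ-toℕ (g′ e) , Fin.toℕ<n (g′ e)) (ℕ.n<1+n _)
    where
      canonical : Fin nE → ℤ
      canonical e = + toℕ (g′ e)

lemma4p4 : (G : OGraph) (p q : ℕ) .{{_ : NonZero p}} .{{_ : NonZero q}} →
  ((f g : Fin (OGraph.nE G) → ℤ) → InKℤ G p q f g →
    InK G p q (λ e → modℤ p (f e)) (λ e → modℤ q (g e)))
  × ((f' : Fin (OGraph.nE G) → Fin p) (g' : Fin (OGraph.nE G) → Fin q) →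
    InK G p q f' g' →
    Σ (Fin (OGraph.nE G) → ℤ) λ f → Σ (Fin (OGraph.nE G) → ℤ) λ g →
      InKℤ G p q f g
      × (∀ e → modℤ p (f e) ≡ f' e) × (∀ e → modℤ q (g e) ≡ g' e))
lemma4p4 G p q = reduce , lift
  where
    open OGraph G using (nE)

    reduce : (f g : Fin nE → ℤ) → InKℤ G p q f g → InK G p q (λ e → modℤ p (f e)) (λ e → modℤ q (g e))
    reduce f g (f-tension , g-flow , edge) =
      Reduction.reduce-tension p G f f-tension , Reduction.reduce-flow q G g g-flow , λ e → reduce-edge p q (f e) (g e) (edge e)

    lift : (f′ : Fin nE → Fin p) (g′ : Fin nE → Fin q) → InK G p q f′ g′ →
           Σ (Fin nE → ℤ) λ f → Σ (Fin nE → ℤ) λ g →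
             InKℤ G p q f g × (∀ e → modℤ p (f e) ≡ f′ e) × (∀ e → modℤ q (g e) ≡ g′ e)
    lift f′ g′ (f′-tension , g′-flow , edge′) =
      let (f , f-tension , f-lifts) = Reduction.lift-tension p G f′ f′-tension
          (g , g-flow , g-lifts)    = FlowLifting.lift G q g′ g′-flow
      in f , g , (f-tension , g-flow , λ e → lift-edge p q (f e) (g e) (f-lifts e) (g-lifts e) (edge′ e)) ,
         (λ e → proj₁ (f-lifts e)) , (λ e → proj₁ (g-lifts e))
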